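{- Let $f:\mathbb{N}\to\mathbb{N}$ be a multiplicative function such that $f(p^{k-1})\le f(p^k)$ for every prime $p$ and integer $k\ge1$. Then every positive integer is $f$-practical if and only if $$f(p^k)\le S_f(p^{k-1})+1$$ holds for every prime $p$ and every integer $k\ge1$.
   Context: $\mathbb{N}$ denotes the positive integers. $S_f(n)=\sum_{d\mid n} f(d)$. A positive integer $n$ is $f$-practical if every positive integer $m\le S_f(n)$ can be written as $m=\sum_{d\in\mathcal{D}} f(d)$ for some set $\mathcal{D}$ of divisors of $n$. -}

module Defs where

open import Data.Nat using (ℕ; zero; suc; _+_; _*_; _^_; _≤_; _<_)
open import Data.Nat.Divisibility using (_∣_; _∣?_)
open import Data.Nat.Coprimality using (Coprime)
open import Data.Nat.Primality using (Prime)
open import Data.List using (List; map; filter; applyUpTo)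
open import Data.Nat.ListAction using (sum)
open import Data.List.Relation.Binary.Sublist.Propositional using (_⊆_)
open import Data.Product using (Σ; _×_)
open import Relation.Binary.PropositionalEquality using (_≡_)

-- Arithmetic functions are modelled as f : ℕ → ℕ; only values at positive
-- arguments matter (f 0 is never used below).

divisors : ℕ → List ℕ
divisors n = filter (_∣? n) (applyUpTo suc n)

S : (ℕ → ℕ) → ℕ → ℕ
S f n = sum (map f (divisors n))

PositiveValued : (ℕ → ℕ) → Set
PositiveValued f = ∀ n → 1 ≤ n → 1 ≤ f n

Multiplicative : (ℕ → ℕ) → Set
Multiplicative f =
  (f 1 ≡ 1) ×
  (∀ m n → 1 ≤ m → 1 ≤ n → Coprime m n → f (m * n) ≡ f m * f n)

-- n is f-practical: every positive m ≤ S_f(n) is Σ_{d∈D} f(d) for some set D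
-- of divisors of n (a set of divisors = a sublist of the duplicate-free list
-- of divisors).
Practical : (ℕ → ℕ) → ℕ → Set
Practical f n =
  ∀ m → 1 ≤ m → m ≤ S f n →
  Σ (List ℕ) (λ D → (D ⊆ divisors n) × (sum (map f D) ≡ m))

{-# OPTIONS --safe #-}
-- Call a list of weights complete when every number up to its total is the
-- sum of a sublist.  If A is complete and b is at most one more than the total
-- of a complete list X, then b·A ++ X is complete (first use as many copies of
-- b as possible, then fill the rest from X).  For p ∤ m the values of f on the
-- divisors of p^(k+1)·m are f(p^(k+1))·(values on divisors of m) followed by
-- the values on divisors of p^k·m, and S_f(p^k·m) = S_f(p^k)·S_f(m) ≥ S_f(p^k);
-- so the prime-power bound makes all values complete, by strong induction on
-- n = p^(k+1)·m.  Conversely, the values on the divisors of p^(k+1) are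
-- f(p^(k+1)) together with those on the divisors of p^k, and a complete list
-- containing b must satisfy b ≤ (total of the others) + 1: the total of the
-- others plus one is not reachable without b.
module Submission where

open import Defs
open import Data.Nat
  using (ℕ; zero; suc; _+_; _*_; _∸_; _^_; _≤_; _<_; _>_; z≤n; s≤s; >-nonZero; nonTrivial⇒n>1)
open import Data.Nat.Properties
open import Data.Nat.Divisibility
open import Data.Nat.Coprimality using (Coprime; coprime-divisor; coprime-factors)
import Data.Nat.Coprimality as Coprimality
open import Data.Nat.Primality using (Prime; prime⇒irreducible; prime⇒nonZero; prime⇒nonTrivial)
open import Data.Nat.Primality.Factorisation using (factorise)
open import Data.Nat.Induction using (<-rec)
open import Data.Nat.ListAction using (sum; product)
open import Data.Nat.ListAction.Properties using (sum-++; sum-↭)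
open import Data.List using (List; []; _∷_; _++_; map; applyUpTo)
open import Data.List.Properties using (map-++; map-∘; map-cong-local)
open import Data.List.Membership.Propositional using (_∈_)
open import Data.List.Membership.Propositional.Properties
  using (∈-filter⁻; ∈-filter⁺; ∈-applyUpTo⁺; ∈-map⁺; ∈-map⁻; ∈-++⁺ˡ; ∈-++⁺ʳ; ∈-++⁻)
open import Data.List.Membership.Propositional.Properties.WithK using (unique∧set⇒bag)
open import Data.List.Relation.Binary.BagAndSetEquality using (∼bag⇒↭)
open import Data.List.Relation.Binary.Permutation.Propositional
  using (_↭_; prep; swap; ↭-sym; ↭-trans; ↭-reflexive)
import Data.List.Relation.Binary.Permutation.Propositional as Perm
import Data.List.Relation.Binary.Permutation.Propositional.Properties as Perm
open import Data.List.Relation.Binary.Sublist.Propositional using (_⊆_; []; _∷_; _∷ʳ_; minimum)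
import Data.List.Relation.Binary.Sublist.Propositional.Properties as Sublist
open import Data.List.Relation.Unary.All using (_∷_; tabulate)
open import Data.List.Relation.Unary.Any using (here; there)
open import Data.List.Relation.Unary.Unique.Propositional using (Unique)
import Data.List.Relation.Unary.Unique.Propositional.Properties as Unique
open import Data.Product using (∃₂; ∃-syntax; _×_; _,_; proj₁; proj₂)
open import Data.Sum using (_⊎_; inj₁; inj₂)
open import Function using (_∘_)
open import Function.Bundles using (mk⇔)
open import Level using (Level)
open import Relation.Nullary using (¬_; yes; no; contradiction)
open import Relation.Binary.PropositionalEquality
  using (_≡_; refl; sym; trans; cong; cong₂; subst; subst₂; module ≡-Reasoning)

private
  variable
    a b : Level
    A : Set a
    B : Set b
    d m n p x : ℕ

⊆-↭ : {ws ws′ xs : List A} → ws ↭ ws′ → xs ⊆ ws → ∃[ xs′ ] xs′ ⊆ ws′ × xs′ ↭ xs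
⊆-↭ Perm.refl s = _ , s , Perm.refl
⊆-↭ (prep x p) (.x ∷ʳ s) = let xs′ , s′ , e = ⊆-↭ p s in xs′ , x ∷ʳ s′ , e
⊆-↭ (prep x p) (refl ∷ s) = let xs′ , s′ , e = ⊆-↭ p s in x ∷ xs′ , refl ∷ s′ , prep x e
⊆-↭ (swap x y p) (.x ∷ʳ .y ∷ʳ s) = let xs′ , s′ , e = ⊆-↭ p s in xs′ , y ∷ʳ x ∷ʳ s′ , e
⊆-↭ (swap x y p) (.x ∷ʳ refl ∷ s) =
  let xs′ , s′ , e = ⊆-↭ p s in y ∷ xs′ , refl ∷ x ∷ʳ s′ , prep y e
⊆-↭ (swap x y p) (refl ∷ .y ∷ʳ s) =
  let xs′ , s′ , e = ⊆-↭ p s in x ∷ xs′ , y ∷ʳ refl ∷ s′ , prep x e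
⊆-↭ (swap x y p) (refl ∷ refl ∷ s) =
  let xs′ , s′ , e = ⊆-↭ p s in y ∷ x ∷ xs′ , refl ∷ refl ∷ s′ , swap y x e
⊆-↭ (Perm.trans p q) s =
  let xs′ , s′ , e = ⊆-↭ p s
      xs″ , s″ , e′ = ⊆-↭ q s′
  in xs″ , s″ , ↭-trans e′ e

⊆-map-lift : (f : A → B) (ys : List A) {xs : List B} → xs ⊆ map f ys →
  ∃[ zs ] zs ⊆ ys × map f zs ≡ xs
⊆-map-lift f [] [] = [] , [] , refl
⊆-map-lift f (y ∷ ys) (.(f y) ∷ʳ s) = let zs , s′ , e = ⊆-map-lift f ys s in zs , y ∷ʳ s′ , e
⊆-map-lift f (y ∷ ys) (refl ∷ s) =
  let zs , s′ , e = ⊆-map-lift f ys s in y ∷ zs , refl ∷ s′ , cong (f y ∷_) e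

∈⇒≤sum : {xs : List ℕ} → x ∈ xs → x ≤ sum xs
∈⇒≤sum {xs = y ∷ ys} (here refl) = m≤m+n y (sum ys)
∈⇒≤sum {xs = y ∷ ys} (there x∈) = ≤-trans (∈⇒≤sum x∈) (m≤n+m (sum ys) y)

sum-⊆ : {xs ws : List ℕ} → xs ⊆ ws → sum xs ≤ sum ws
sum-⊆ [] = z≤n
sum-⊆ (y ∷ʳ s) = ≤-trans (sum-⊆ s) (m≤n+m _ y)
sum-⊆ (refl ∷ s) = +-monoʳ-≤ _ (sum-⊆ s)

sum-map-* : ∀ b xs → sum (map (b *_) xs) ≡ b * sum xs
sum-map-* b [] = sym (*-zeroʳ b)
sum-map-* b (x ∷ xs) = trans (cong (b * x +_) (sum-map-* b xs)) (sym (*-distribˡ-+ b x (sum xs)))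

sum-map-*-++ : ∀ b ys zs → sum (map (b *_) ys ++ zs) ≡ b * sum ys + sum zs
sum-map-*-++ b ys zs = trans (sum-++ (map (b *_) ys) zs) (cong (_+ sum zs) (sum-map-* b ys))

Complete : List ℕ → Set
Complete ws = ∀ m → m ≤ sum ws → ∃[ xs ] xs ⊆ ws × sum xs ≡ m

complete-[1] : Complete (1 ∷ [])
complete-[1] zero _ = [] , minimum _ , refl
complete-[1] (suc zero) _ = 1 ∷ [] , refl ∷ [] , refl
complete-[1] (suc (suc _)) (s≤s ())

complete-↭ : {ws ws′ : List ℕ} → ws ↭ ws′ → Complete ws → Complete ws′
complete-↭ ws↭ws′ c m m≤ =
  let xs , xs⊆ , xs-sum = c m (subst (m ≤_) (sym (sum-↭ ws↭ws′)) m≤)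
      xs′ , xs′⊆ , xs′↭xs = ⊆-↭ ws↭ws′ xs⊆
  in xs′ , xs′⊆ , trans (sum-↭ xs′↭xs) xs-sum

decompose-≤*+ : ∀ {b s} → b ≤ s + 1 → ∀ a {t} → t ≤ b * a + s →
  ∃₂ λ a′ y → a′ ≤ a × y ≤ s × t ≡ b * a′ + y
decompose-≤*+ {b} {s} b≤ zero {t} t≤ =
  0 , t , z≤n , subst (t ≤_) (cong (_+ s) (*-zeroʳ b)) t≤ , cong (_+ t) (sym (*-zeroʳ b))
decompose-≤*+ {b} {s} b≤ (suc a) {t} t≤ with t ≤? b * a + s
... | yes t≤′ =
  let a′ , y , a′≤ , y≤ , t≡ = decompose-≤*+ b≤ a t≤′ in a′ , y , m≤n⇒m≤1+n a′≤ , y≤ , t≡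
... | no t≰ = suc a , t ∸ b * suc a , ≤-refl , rest≤s , sym (m+[n∸m]≡n b[1+a]≤t)
  where
  open ≤-Reasoning
  b[1+a]≤t : b * suc a ≤ t
  b[1+a]≤t = begin
    b * suc a         ≡⟨ *-suc b a ⟩
    b + b * a         ≤⟨ +-monoˡ-≤ (b * a) b≤ ⟩
    s + 1 + b * a     ≡⟨ trans (cong (_+ b * a) (+-comm s 1)) (+-comm (suc s) (b * a)) ⟩
    b * a + suc s     ≡⟨ +-suc (b * a) s ⟩
    suc (b * a + s)   ≤⟨ ≰⇒> t≰ ⟩
    t                 ∎
  rest≤s : t ∸ b * suc a ≤ s
  rest≤s = begin
    t ∸ b * suc a              ≤⟨ ∸-monoˡ-≤ (b * suc a) t≤ ⟩
    b * suc a + s ∸ b * suc a  ≡⟨ m+n∸m≡n (b * suc a) s ⟩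
    s                          ∎

complete-*-++ : ∀ {b as xs} → Complete as → Complete xs → b ≤ sum xs + 1 →
  Complete (map (b *_) as ++ xs)
complete-*-++ {b} {as} {xs} complete-as complete-xs b≤ t t≤ =
  let a′ , y , a′≤ , y≤ , t≡ = decompose-≤*+ b≤ (sum as) (subst (t ≤_) (sum-map-*-++ b as xs) t≤)
      ys , ys⊆ , ys-sum = complete-as a′ a′≤
      zs , zs⊆ , zs-sum = complete-xs y y≤
  in map (b *_) ys ++ zs ,
     Sublist.++⁺ (Sublist.map⁺ (b *_) ys⊆) zs⊆ ,
     trans (sum-map-*-++ b ys zs) (trans (cong₂ (λ u v → b * u + v) ys-sum zs-sum) (sym t≡))

complete-∷⇒≤sum+1 : ∀ {b ws} → 1 ≤ b → Complete (b ∷ ws) → b ≤ sum ws + 1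
complete-∷⇒≤sum+1 {b} {ws} 1≤b complete =
  subst (b ≤_) (+-comm 1 (sum ws)) (use (complete (suc (sum ws)) (+-monoˡ-≤ (sum ws) 1≤b)))
  where
  use : ∃[ xs ] xs ⊆ b ∷ ws × sum xs ≡ suc (sum ws) → b ≤ suc (sum ws)
  use (.b ∷ ys , refl ∷ _ , ys-sum) = subst (b ≤_) ys-sum (m≤m+n b (sum ys))
  use (xs , .b ∷ʳ xs⊆ , xs-sum) = contradiction (subst (_≤ sum ws) xs-sum (sum-⊆ xs⊆)) (<-irrefl refl)

divisor-positive : 1 ≤ n → d ∣ n → 1 ≤ d
divisor-positive {d = zero} 1≤n 0∣n = contradiction (sym (0∣⇒≡0 0∣n)) (<⇒≢ 1≤n)
divisor-positive {d = suc d} _ _ = s≤s z≤n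

∈-divisors⁻ : x ∈ divisors n → x ∣ n
∈-divisors⁻ {n = n} x∈ = proj₂ (∈-filter⁻ (_∣? n) {xs = applyUpTo suc n} x∈)

∈-divisors⁺ : 1 ≤ n → x ∣ n → x ∈ divisors n
∈-divisors⁺ {n} {zero} 1≤n 0∣n = contradiction (sym (0∣⇒≡0 0∣n)) (<⇒≢ 1≤n)
∈-divisors⁺ {n} {suc x} 1≤n x∣n =
  ∈-filter⁺ (_∣? n) (∈-applyUpTo⁺ suc (∣⇒≤ {{>-nonZero 1≤n}} x∣n)) x∣n

divisors-unique : ∀ n → Unique (divisors n)
divisors-unique n =
  Unique.filter⁺ (_∣? n) (Unique.applyUpTo⁺₁ suc n (λ i<j _ → <⇒≢ i<j ∘ suc-injective))

prime>1 : Prime p → 1 < p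
prime>1 {p} pp = nonTrivial⇒n>1 p {{prime⇒nonTrivial pp}}

prime^>0 : Prime p → ∀ j → p ^ j > 0
prime^>0 {p} pp = m^n>0 p {{prime⇒nonZero pp}}

prime∤1 : Prime p → ¬ p ∣ 1
prime∤1 pp p∣1 = <⇒≢ (prime>1 pp) (sym (∣1⇒≡1 p∣1))

prime∤⇒coprime : Prime p → ¬ p ∣ d → Coprime p d
prime∤⇒coprime pp p∤d (i∣p , i∣d) with prime⇒irreducible pp i∣p
... | inj₁ i≡1 = i≡1
... | inj₂ refl = contradiction i∣d p∤d

coprime-*ˡ : ∀ {a b c} → Coprime a c → Coprime b c → Coprime (a * b) c
coprime-*ˡ {b = b} coprime-ac coprime-bc (i∣ab , i∣c) =
  coprime-bc (coprime-factors coprime-ac (i∣ab , ∣m⇒∣m*n b i∣c) , i∣c)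

prime∤⇒coprime-^ : Prime p → ¬ p ∣ d → ∀ j → Coprime (p ^ j) d
prime∤⇒coprime-^ pp p∤d zero (i∣1 , _) = ∣1⇒≡1 i∣1
prime∤⇒coprime-^ pp p∤d (suc j) = coprime-*ˡ (prime∤⇒coprime pp p∤d) (prime∤⇒coprime-^ pp p∤d j)

∣p*n-cases : Prime p → x ∣ p * n → x ∣ n ⊎ ∃[ y ] x ≡ p * y × y ∣ n
∣p*n-cases {p} {x} {n} pp x∣pn with p ∣? x
... | no p∤x = inj₁ (coprime-divisor (Coprimality.sym (prime∤⇒coprime pp p∤x)) x∣pn)
... | yes (divides y refl) = inj₂ (y , *-comm y p ,
  *-cancelˡ-∣ p {{prime⇒nonZero pp}} (subst (_∣ p * n) (*-comm y p) x∣pn))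

∣p^[1+k]*m-cases : Prime p → ∀ k → x ∣ p ^ suc k * m →
  x ∣ p ^ k * m ⊎ ∃[ y ] x ≡ p ^ suc k * y × y ∣ m
∣p^[1+k]*m-cases {p} {x} {m} pp k x∣ with ∣p*n-cases pp (subst (x ∣_) (*-assoc p (p ^ k) m) x∣)
... | inj₁ x∣p^k*m = inj₁ x∣p^k*m
∣p^[1+k]*m-cases {p} {x} {m} pp zero x∣ | inj₂ (y , x≡py , y∣1*m) =
  inj₂ (y , trans x≡py (cong (_* y) (sym (*-identityʳ p))) , subst (y ∣_) (*-identityˡ m) y∣1*m)
∣p^[1+k]*m-cases {p} {x} {m} pp (suc k) x∣ | inj₂ (y , x≡py , y∣) with ∣p^[1+k]*m-cases pp k y∣
... | inj₁ y∣p^k*m = inj₁ (subst (_∣ p ^ suc k * m) (sym x≡py)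
  (subst (p * y ∣_) (sym (*-assoc p (p ^ k) m)) (*-monoʳ-∣ p y∣p^k*m)))
... | inj₂ (z , y≡ , z∣m) =
  inj₂ (z , trans x≡py (trans (cong (p *_) y≡) (sym (*-assoc p (p ^ suc k) z))) , z∣m)

p^[1+k]*d∤p^k*m : Prime p → ¬ p ∣ m → ∀ k d → ¬ (p ^ suc k * d ∣ p ^ k * m)
p^[1+k]*d∤p^k*m {p} {m} pp p∤m k d h =
  p∤m (m*n∣⇒m∣ p d (*-cancelˡ-∣ (p ^ k) {{m^n≢0 p k {{prime⇒nonZero pp}}}}
    (subst (_∣ p ^ k * m) regroup h)))
  where
  regroup : p ^ suc k * d ≡ p ^ k * (p * d)
  regroup = trans (cong (_* d) (*-comm p (p ^ k))) (*-assoc (p ^ k) p d)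

divisors-p^[1+k]*m-↭ : Prime p → ¬ p ∣ m → 1 ≤ m → ∀ k →
  divisors (p ^ suc k * m) ↭ map (p ^ suc k *_) (divisors m) ++ divisors (p ^ k * m)
divisors-p^[1+k]*m-↭ {p} {m} pp p∤m 1≤m k =
  ∼bag⇒↭ (unique∧set⇒bag (divisors-unique (q * m)) rhs-unique (mk⇔ to from))
  where
  q : ℕ
  q = p ^ suc k
  rhs : List ℕ
  rhs = map (q *_) (divisors m) ++ divisors (p ^ k * m)

  p^j*m>0 : ∀ j → 1 ≤ p ^ j * m
  p^j*m>0 j = *-mono-≤ (prime^>0 pp j) 1≤m

  rhs-unique : Unique rhs
  rhs-unique = Unique.++⁺
    (Unique.map⁺ (*-cancelˡ-≡ _ _ q {{m^n≢0 p (suc k) {{prime⇒nonZero pp}}}}) (divisors-unique m))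
    (divisors-unique (p ^ k * m))
    (λ (x∈l , x∈r) → let d , _ , x≡qd = ∈-map⁻ (q *_) x∈l in
      p^[1+k]*d∤p^k*m pp p∤m k d (subst (_∣ p ^ k * m) x≡qd (∈-divisors⁻ x∈r)))

  to : x ∈ divisors (q * m) → x ∈ rhs
  to x∈ with ∣p^[1+k]*m-cases pp k (∈-divisors⁻ x∈)
  ... | inj₁ x∣ = ∈-++⁺ʳ _ (∈-divisors⁺ (p^j*m>0 k) x∣)
  ... | inj₂ (d , refl , d∣m) = ∈-++⁺ˡ (∈-map⁺ (q *_) (∈-divisors⁺ 1≤m d∣m))

  from : x ∈ rhs → x ∈ divisors (q * m)
  from x∈ with ∈-++⁻ (map (q *_) (divisors m)) x∈
  ... | inj₁ x∈l = let d , d∈ , x≡qd = ∈-map⁻ (q *_) x∈l in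
    ∈-divisors⁺ (p^j*m>0 (suc k)) (subst (_∣ q * m) (sym x≡qd) (*-monoʳ-∣ q (∈-divisors⁻ d∈)))
  ... | inj₂ x∈r =
    ∈-divisors⁺ (p^j*m>0 (suc k)) (∣-trans (∈-divisors⁻ x∈r) (*-monoˡ-∣ m (n∣m*n p)))

divisors-p^[1+k]-↭ : Prime p → ∀ k → divisors (p ^ suc k) ↭ p ^ suc k ∷ divisors (p ^ k)
divisors-p^[1+k]-↭ {p} pp k = subst₂ _↭_
  (cong divisors (*-identityʳ (p ^ suc k)))
  (cong₂ (λ u v → u ∷ divisors v) (*-identityʳ (p ^ suc k)) (*-identityʳ (p ^ k)))
  (divisors-p^[1+k]*m-↭ pp (prime∤1 pp) ≤-refl k)

S-p^[1+k] : ∀ f → Prime p → ∀ k → S f (p ^ suc k) ≡ f (p ^ suc k) + S f (p ^ k)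
S-p^[1+k] f pp k = sum-↭ (Perm.map⁺ f (divisors-p^[1+k]-↭ pp k))

PAdicSplit : ℕ → ℕ → Set
PAdicSplit p n = ∃₂ λ k m → n ≡ p ^ k * m × ¬ p ∣ m × 1 ≤ m

p-adic-split : Prime p → ∀ n → 1 ≤ n → PAdicSplit p n
p-adic-split {p} pp = <-rec _ split
  where
  split : ∀ n → (∀ {n′} → n′ < n → 1 ≤ n′ → PAdicSplit p n′) → 1 ≤ n → PAdicSplit p n
  split n rec 1≤n with p ∣? n
  ... | no p∤n = 0 , n , sym (*-identityˡ n) , p∤n , 1≤n
  ... | yes p∣n@(divides q n≡qp) =
    let k , m , q≡ , p∤m , 1≤m = rec (quotient-< p∣n {{prime⇒nonTrivial pp}} {{>-nonZero 1≤n}})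
                                     (divisor-positive 1≤n (quotient-∣ p∣n))
        n≡ : n ≡ p ^ suc k * m
        n≡ = begin
          n                ≡⟨ n≡qp ⟩
          q * p            ≡⟨ cong (_* p) q≡ ⟩
          p ^ k * m * p    ≡⟨ *-comm (p ^ k * m) p ⟩
          p * (p ^ k * m)  ≡⟨ *-assoc p (p ^ k) m ⟨
          p ^ suc k * m    ∎
    in suc k , m , n≡ , p∤m , 1≤m
    where open ≡-Reasoning

prime-divisor : 1 < n → ∃[ p ] Prime p × p ∣ n
prime-divisor {n} 1<n with factorise n {{>-nonZero (<-trans (s≤s z≤n) 1<n)}}
... | record { factors = [] ; isFactorisation = n≡1 } = contradiction (sym n≡1) (<⇒≢ 1<n)
... | record { factors = p ∷ ps ; isFactorisation = n≡ ; factorsPrime = pp ∷ _ } =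
  p , pp , divides (product ps) (trans n≡ (*-comm p (product ps)))

PrimePowerBound : (ℕ → ℕ) → Set
PrimePowerBound f = ∀ p k → Prime p → f (p ^ suc k) ≤ S f (p ^ k) + 1

module _ {f : ℕ → ℕ} (f-mult : Multiplicative f) where

  private
    f-1 : f 1 ≡ 1
    f-1 = proj₁ f-mult

  S-1 : S f 1 ≡ 1
  S-1 = trans (+-identityʳ (f 1)) f-1

  S-positive : 1 ≤ n → 1 ≤ S f n
  S-positive {n} 1≤n = subst (_≤ S f n) f-1 (∈⇒≤sum (∈-map⁺ f (∈-divisors⁺ 1≤n (1∣ n))))

  f-p^j*d : Prime p → ¬ p ∣ d → 1 ≤ d → ∀ j → f (p ^ j * d) ≡ f (p ^ j) * f d
  f-p^j*d {p} {d} pp p∤d 1≤d j =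
    proj₂ f-mult (p ^ j) d (prime^>0 pp j) 1≤d (prime∤⇒coprime-^ pp p∤d j)

  map-f-divisors-p^[1+k]*m-↭ : Prime p → ¬ p ∣ m → 1 ≤ m → ∀ k →
    map f (divisors (p ^ suc k * m)) ↭
    map (f (p ^ suc k) *_) (map f (divisors m)) ++ map f (divisors (p ^ k * m))
  map-f-divisors-p^[1+k]*m-↭ {p} {m} pp p∤m 1≤m k =
    ↭-trans (Perm.map⁺ f (divisors-p^[1+k]*m-↭ pp p∤m 1≤m k))
            (↭-reflexive (trans (map-++ f _ rest) (cong (_++ map f rest) f-scaled)))
    where
    open ≡-Reasoning
    q : ℕ
    q = p ^ suc k
    rest : List ℕ
    rest = divisors (p ^ k * m)
    f-q*d : ∀ {d} → d ∈ divisors m → f (q * d) ≡ f q * f d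
    f-q*d {d} d∈ = f-p^j*d pp (λ p∣d → p∤m (∣-trans p∣d d∣m)) (divisor-positive 1≤m d∣m) (suc k)
      where
      d∣m : d ∣ m
      d∣m = ∈-divisors⁻ d∈
    f-scaled : map f (map (q *_) (divisors m)) ≡ map (f q *_) (map f (divisors m))
    f-scaled = begin
      map f (map (q *_) (divisors m))      ≡⟨ map-∘ (divisors m) ⟨
      map (f ∘ (q *_)) (divisors m)        ≡⟨ map-cong-local (tabulate f-q*d) ⟩
      map ((f q *_) ∘ f) (divisors m)      ≡⟨ map-∘ (divisors m) ⟩
      map (f q *_) (map f (divisors m))    ∎

  S-p^k*m : Prime p → ¬ p ∣ m → 1 ≤ m → ∀ k → S f (p ^ k * m) ≡ S f (p ^ k) * S f m
  S-p^k*m {p} {m} pp p∤m 1≤m zero = begin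
    S f (1 * m)      ≡⟨ cong (S f) (*-identityˡ m) ⟩
    S f m            ≡⟨ *-identityˡ (S f m) ⟨
    1 * S f m        ≡⟨ cong (_* S f m) S-1 ⟨
    S f 1 * S f m    ∎
    where open ≡-Reasoning
  S-p^k*m {p} {m} pp p∤m 1≤m (suc k) = begin
    S f (p ^ suc k * m)                            ≡⟨ sum-↭ (map-f-divisors-p^[1+k]*m-↭ pp p∤m 1≤m k) ⟩
    sum (map (f q *_) (map f (divisors m)) ++ map f (divisors (p ^ k * m)))
                                                   ≡⟨ sum-map-*-++ (f q) (map f (divisors m)) _ ⟩
    f q * S f m + S f (p ^ k * m)                  ≡⟨ cong (f q * S f m +_) (S-p^k*m pp p∤m 1≤m k) ⟩
    f q * S f m + S f (p ^ k) * S f m              ≡⟨ *-distribʳ-+ (S f m) (f q) _ ⟨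
    (f q + S f (p ^ k)) * S f m                    ≡⟨ cong (_* S f m) (S-p^[1+k] f pp k) ⟨
    S f q * S f m                                  ∎
    where
    open ≡-Reasoning
    q : ℕ
    q = p ^ suc k

  complete-p^k*m : Prime p → ¬ p ∣ m → 1 ≤ m → PrimePowerBound f →
    Complete (map f (divisors m)) → ∀ k → Complete (map f (divisors (p ^ k * m)))
  complete-p^k*m {m = m} pp p∤m 1≤m bound complete-m zero =
    subst (Complete ∘ map f ∘ divisors) (sym (*-identityˡ m)) complete-m
  complete-p^k*m {p} {m} pp p∤m 1≤m bound complete-m (suc k) =
    complete-↭ (↭-sym (map-f-divisors-p^[1+k]*m-↭ pp p∤m 1≤m k))
      (complete-*-++ complete-m (complete-p^k*m pp p∤m 1≤m bound complete-m k)
        (≤-trans (bound p k pp) (+-monoˡ-≤ 1 S-p^k≤S-p^k*m)))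
    where
    S-p^k≤S-p^k*m : S f (p ^ k) ≤ S f (p ^ k * m)
    S-p^k≤S-p^k*m = subst (S f (p ^ k) ≤_) (sym (S-p^k*m pp p∤m 1≤m k))
      (m≤m*n (S f (p ^ k)) (S f m) {{>-nonZero (S-positive 1≤m)}})

  complete-divisors : PrimePowerBound f → ∀ n → 1 ≤ n → Complete (map f (divisors n))
  complete-divisors bound = <-rec _ step
    where
    step : ∀ n → (∀ {m} → m < n → 1 ≤ m → Complete (map f (divisors m))) →
      1 ≤ n → Complete (map f (divisors n))
    step (suc zero) _ _ = subst (λ v → Complete (v ∷ [])) (sym f-1) complete-[1]
    step n@(suc (suc _)) rec 1≤n with prime-divisor {n} (s≤s (s≤s z≤n))
    ... | p , pp , p∣n with p-adic-split pp n 1≤n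
    ...   | zero , m , n≡m , p∤m , _ = contradiction (subst (p ∣_) (trans n≡m (*-identityˡ m)) p∣n) p∤m
    ...   | suc k , m , n≡ , p∤m , 1≤m =
      subst (Complete ∘ map f ∘ divisors) (sym n≡)
        (complete-p^k*m pp p∤m 1≤m bound (rec m<n 1≤m) (suc k))
      where
      m<n : m < n
      m<n = subst (m <_) (trans (*-comm m (p ^ suc k)) (sym n≡))
        (m<m*n m (p ^ suc k) {{>-nonZero 1≤m}} (*-mono-≤ (prime>1 pp) (prime^>0 pp k)))

complete⇒practical : ∀ f n → Complete (map f (divisors n)) → Practical f n
complete⇒practical f n complete m _ m≤ =
  let xs , xs⊆ , xs-sum = complete m m≤
      D , D⊆ , map≡ = ⊆-map-lift f (divisors n) xs⊆
  in D , D⊆ , trans (cong sum map≡) xs-sum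

practical⇒complete : ∀ f n → Practical f n → Complete (map f (divisors n))
practical⇒complete f n practical zero _ = [] , minimum _ , refl
practical⇒complete f n practical m@(suc _) m≤ =
  let D , D⊆ , D-sum = practical m (s≤s z≤n) m≤ in map f D , Sublist.map⁺ f D⊆ , D-sum

practical⇒prime-power-bound : ∀ f → PositiveValued f → (∀ n → 1 ≤ n → Practical f n) →
  PrimePowerBound f
practical⇒prime-power-bound f pos practical p k pp =
  complete-∷⇒≤sum+1 (pos _ (prime^>0 pp (suc k)))
    (complete-↭ (Perm.map⁺ f (divisors-p^[1+k]-↭ pp k))
      (practical⇒complete f (p ^ suc k) (practical _ (prime^>0 pp (suc k)))))

theorem2p7 : (f : ℕ → ℕ) → PositiveValued f → Multiplicative f →
    (∀ p k → Prime p → 1 ≤ k → f (p ^ (k ∸ 1)) ≤ f (p ^ k)) →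
    ((∀ n → 1 ≤ n → Practical f n) → (∀ p k → Prime p → 1 ≤ k → f (p ^ k) ≤ S f (p ^ (k ∸ 1)) + 1))
    × ((∀ p k → Prime p → 1 ≤ k → f (p ^ k) ≤ S f (p ^ (k ∸ 1)) + 1) → (∀ n → 1 ≤ n → Practical f n))
theorem2p7 f pos f-mult _ =
  (λ { practical p (suc k) pp _ → practical⇒prime-power-bound f pos practical p k pp }) ,
  (λ bound n 1≤n → complete⇒practical f n
    (complete-divisors f-mult (λ p k pp → bound p (suc k) pp (s≤s z≤n)) n 1≤n))
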